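{- Let $\mathcal B$ be a pre-matroid on a finite set $X$ and let $\omega,\pi,a,z,\varepsilon$ be as in the context. Suppose $Q$ and $\varepsilon(Q)$ are both almost-bases of $\mathcal B$ and both are non-branching. Then $Q$ is balanced if and only if $\varepsilon(\varphi(Q))=\varphi(\varepsilon(Q))$, and if and only if $\varepsilon(Q)$ is balanced.
   Context: A pre-matroid on a finite set $X$ is a non-empty set $\mathcal B$ of subsets of $X$ (bases). For $Y\subseteq X$, $x\notin Y$, $Y+x=Y\cup\{x\}$; for $y\in Y$, $Y-y=Y\setminus\{y\}$. An almost-basis is $B-x$ with $B\in\mathcal B$, $x\in B$; $U(D)=\{x\notin D: D+x\in\mathcal B\}$. For a linear order $\rho$ on $X$ and an almost-basis $D$, $\varphi_\rho(D)=D+\min_\rho U(D)$. Let $\omega$ be a linear order on $X$, $a\ne z$ consecutive for $\omega$ with $a<_\omega z$, $\varepsilon$ the transposition exchanging $a,z$ (acting on subsets elementwise), and $\pi$ the linear order agreeing with $\omega$ except $z<_\pi a$. An almost-basis $D$ is non-branching if $\varphi_\omega(D)=\varphi_\pi(D)$, and then $\varphi(D)$ denotes this common value. An almost-basis $Q$ is balanced if $\varepsilon(Q)$ is an almost-basis, $\varepsilon(\varphi_\omega(Q))=\varphi_\pi(\varepsilon(Q))$ and $\varepsilon(\varphi_\pi(Q))=\varphi_\omega(\varepsilon(Q))$. -}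

module Defs where

open import Data.Nat using (ℕ; suc)
open import Data.Fin using (Fin; toℕ)
open import Data.Fin.Subset using (Subset; _∈_; _∪_; ⁅_⁆; _-_)
open import Data.Fin.Permutation using (Permutation′; _⟨$⟩ʳ_; _⟨$⟩ˡ_; transpose; _∘ₚ_)
open import Data.Vec using (lookup; tabulate)
open import Data.List using (List; []; _∷_; map; allFin)
open import Data.Bool using (Bool; true; false; not; _∧_)
open import Data.Maybe using (Maybe; just; nothing; maybe)
open import Data.Product using (Σ; ∃; ∃₂; _×_)
open import Relation.Binary.PropositionalEquality using (_≡_)

record PreMatroid (n : ℕ) : Set where
  field
    isBasis  : Subset n → Bool
    nonEmpty : ∃ λ B → isBasis B ≡ true
open PreMatroid public

-- A linear order on Fin n is encoded as a permutation ρ : the rank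
-- (position) of x is ρ ⟨$⟩ʳ x, and x <_ρ y iff rank x < rank y.
LinOrder : ℕ → Set
LinOrder = Permutation′

module _ {n : ℕ} (M : PreMatroid n) where

  AlmostBasis : Subset n → Set
  AlmostBasis D = ∃₂ λ B x → isBasis M B ≡ true × x ∈ B × D ≡ B - x

  U : Subset n → Fin n → Bool
  U D x = not (lookup D x) ∧ isBasis M (D ∪ ⁅ x ⁆)

firstIn : {n : ℕ} → List (Fin n) → (Fin n → Bool) → Maybe (Fin n)
firstIn []       P = nothing
firstIn (x ∷ xs) P with P x
... | true  = just x
... | false = firstIn xs P

minBy : {n : ℕ} → LinOrder n → (Fin n → Bool) → Maybe (Fin n)
minBy {n} ρ P = firstIn (map (ρ ⟨$⟩ˡ_) (allFin n)) P

-- φ_ρ(D) = D + min_ρ U(D).  (U(D) is non-empty for every almost-basis D,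
-- so the fallback value D is never used for almost-bases.)
φ : {n : ℕ} → PreMatroid n → LinOrder n → Subset n → Subset n
φ M ρ D = maybe (λ x → D ∪ ⁅ x ⁆) D (minBy ρ (U M D))

ε : {n : ℕ} → Fin n → Fin n → Subset n → Subset n
ε a z S = tabulate (λ i → lookup S (transpose a z ⟨$⟩ʳ i))

Consecutive : {n : ℕ} → LinOrder n → Fin n → Fin n → Set
Consecutive ω a z = toℕ (ω ⟨$⟩ʳ z) ≡ suc (toℕ (ω ⟨$⟩ʳ a))

-- π: agrees with ω except that z <_π a  (rank_π x = rank_ω (ε x))
πOrder : {n : ℕ} → LinOrder n → Fin n → Fin n → LinOrder n
πOrder ω a z = transpose a z ∘ₚ ω

module _ {n : ℕ} (M : PreMatroid n) (ω : LinOrder n) (a z : Fin n) where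

  NonBranching : Subset n → Set
  NonBranching D = φ M ω D ≡ φ M (πOrder ω a z) D

  Balanced : Subset n → Set
  Balanced Q = AlmostBasis M (ε a z Q)
             × ε a z (φ M ω Q) ≡ φ M (πOrder ω a z) (ε a z Q)
             × ε a z (φ M (πOrder ω a z) Q) ≡ φ M ω (ε a z Q)

-- Since ε is an involution, the two defining equations of "Q is balanced"
-- are one and the same equation ε(φ Q) = φ(ε Q) once the ω- and π-values
-- of φ agree at Q and at ε Q; that equation is symmetric in Q and ε Q.
module Submission where

open import Defs
open import Data.Nat using (ℕ)
open import Data.Fin using (Fin; _≟_)
open import Data.Fin.Subset using (Subset)
open import Data.Fin.Permutation using (transpose; _⟨$⟩ʳ_)
import Data.Fin.Permutation.Components as PC
open import Data.Vec using (lookup)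
open import Data.Vec.Properties using (lookup∘tabulate; tabulate∘lookup; tabulate-cong)
open import Data.Product using (_×_; _,_)
open import Function.Bundles using (_⇔_; mk⇔)
import Function.Properties.Equivalence as ⇔
open import Relation.Binary.PropositionalEquality
  using (_≡_; _≢_; refl; sym; trans; cong; subst)
open import Relation.Nullary using (yes; no)
open import Relation.Nullary.Decidable using (dec-true; dec-false)

transpose-comm : ∀ {n} (i j k : Fin n) → PC.transpose i j k ≡ PC.transpose j i k
transpose-comm i j k with k ≟ i | k ≟ j
... | yes refl | yes refl = refl
... | yes refl | no  k≢j  rewrite dec-true (k ≟ k) refl = refl
... | no  k≢i  | yes refl rewrite dec-true (k ≟ k) refl = refl
... | no  k≢i  | no  k≢j  rewrite dec-false (k ≟ i) k≢i | dec-false (k ≟ j) k≢j = refl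

transpose-involutive : ∀ {n} (i j k : Fin n) → PC.transpose i j (PC.transpose i j k) ≡ k
transpose-involutive i j k =
  trans (cong (PC.transpose i j) (transpose-comm i j k)) (PC.transpose-inverse i j)

ε-involutive : ∀ {n} (a z : Fin n) (S : Subset n) → ε a z (ε a z S) ≡ S
ε-involutive a z S = trans (tabulate-cong swap-twice) (tabulate∘lookup S)
  where
  τ : Fin _ → Fin _
  τ = transpose a z ⟨$⟩ʳ_
  swap-twice : ∀ i → lookup (ε a z S) (τ i) ≡ lookup S i
  swap-twice i = trans (lookup∘tabulate (λ j → lookup S (τ j)) (τ i))
                       (cong (lookup S) (transpose-involutive a z i))

module _ {A : Set} (f : A → A) (f-involutive : ∀ x → f (f x) ≡ x) where

  involution-flip : ∀ {x y} → f x ≡ y → f y ≡ x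
  involution-flip {x} refl = f-involutive x

  involution-commutes-symmetric : (g : A → A) (x : A) →
    (f (g x) ≡ g (f x)) ⇔ (f (g (f x)) ≡ g (f (f x)))
  involution-commutes-symmetric g x = mk⇔
    (λ fg≡gf → subst (f (g (f x)) ≡_) (cong g (sym (f-involutive x))) (involution-flip fg≡gf))
    (λ fgf≡gff → involution-flip (subst (f (g (f x)) ≡_) (cong g (f-involutive x)) fgf≡gff))

balanced⇔ε-commutes-with-φ : ∀ {n} (M : PreMatroid n) (ω : LinOrder n) (a z : Fin n)
  (Q : Subset n) →
  AlmostBasis M (ε a z Q) →
  NonBranching M ω a z Q → NonBranching M ω a z (ε a z Q) →
  Balanced M ω a z Q ⇔ (ε a z (φ M ω Q) ≡ φ M ω (ε a z Q))
balanced⇔ε-commutes-with-φ M ω a z Q abεQ nbQ nbεQ = mk⇔ to from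
  where
  to : Balanced M ω a z Q → ε a z (φ M ω Q) ≡ φ M ω (ε a z Q)
  to (_ , εφω≡φπε , _) = trans εφω≡φπε (sym nbεQ)

  from : ε a z (φ M ω Q) ≡ φ M ω (ε a z Q) → Balanced M ω a z Q
  from εφ≡φε = abεQ , trans εφ≡φε nbεQ , trans (cong (ε a z) (sym nbQ)) εφ≡φε

lemma8p2 : {n : ℕ} (M : PreMatroid n) (ω : LinOrder n) (a z : Fin n) →
    a ≢ z → Consecutive ω a z →
    (Q : Subset n) →
    AlmostBasis M Q → AlmostBasis M (ε a z Q) →
    NonBranching M ω a z Q → NonBranching M ω a z (ε a z Q) →
    (Balanced M ω a z Q ⇔ (ε a z (φ M ω Q) ≡ φ M ω (ε a z Q)))
    × (Balanced M ω a z Q ⇔ Balanced M ω a z (ε a z Q))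
lemma8p2 M ω a z _ _ Q abQ abεQ nbQ nbεQ =
  balancedQ⇔commutes ,
  ⇔.trans balancedQ⇔commutes
    (⇔.trans (involution-commutes-symmetric (ε a z) (ε-involutive a z) (φ M ω) Q)
             (⇔.sym balancedεQ⇔commutes))
  where
  εεQ≡Q : ε a z (ε a z Q) ≡ Q
  εεQ≡Q = ε-involutive a z Q

  balancedQ⇔commutes : Balanced M ω a z Q ⇔ (ε a z (φ M ω Q) ≡ φ M ω (ε a z Q))
  balancedQ⇔commutes = balanced⇔ε-commutes-with-φ M ω a z Q abεQ nbQ nbεQ

  balancedεQ⇔commutes : Balanced M ω a z (ε a z Q) ⇔
                        (ε a z (φ M ω (ε a z Q)) ≡ φ M ω (ε a z (ε a z Q)))
  balancedεQ⇔commutes = balanced⇔ε-commutes-with-φ M ω a z (ε a z Q)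
    (subst (AlmostBasis M) (sym εεQ≡Q) abQ)
    nbεQ
    (subst (NonBranching M ω a z) (sym εεQ≡Q) nbQ)
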